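{- Let $\varphi$ be an rLTL$(\boxdot,\dot{\Diamond})$ formula over $\mathcal P$, $\Sigma=2^{\mathcal P}$, and $b\in\mathbb B_4$. Then the automaton $\mathcal A_\varphi$ accepts $\sigma\in\Sigma^\omega$ when starting in state $q_b$ (i.e., there is a run of $\mathcal A_\varphi$ on $\sigma$ starting in $q_b$ that visits every set in $\mathcal F$ infinitely often) if and only if $V(\sigma,\varphi)=b$.
   Context: Let $\mathcal P$ be a nonempty finite set of atomic propositions, $\Sigma=2^{\mathcal P}$; $\sigma(i)$ is the $i$-th symbol of $\sigma\in\Sigma^\omega$ and $\sigma_{i..}=\sigma(i)\sigma(i+1)\cdots$. $\mathbb B_4=\{0000,0001,0011,0111,1111\}\subseteq\{0,1\}^4$, totally ordered by $0000\prec0001\prec0011\prec0111\prec1111$; $\min,\max$ refer to this order; $\overline{a}=0000$ if $a=1111$ and $1111$ otherwise; $a\rightarrow b=1111$ if $a\preceq b$ and $b$ otherwise; $\pi_k$ is the $k$-th coordinate projection. rLTL$(\boxdot,\dot{\Diamond})$ formulas: $p\in\mathcal P$, $\neg\varphi$, $\varphi\lor\psi$, $\varphi\land\psi$, $\varphi\Rightarrow\psi$, $\boxdot\varphi$, $\dot{\Diamond}\varphi$. Valuation $V(\sigma,\varphi)\in\mathbb B_4$, $V_k=\pi_k\circ V$: $V(\sigma,p)=1111$ if $p\in\sigma(0)$, else $0000$; $\land$ is $\min$, $\lor$ is $\max$, $V(\sigma,\neg\varphi)=\overline{V(\sigma,\varphi)}$, $V(\sigma,\varphi\Rightarrow\psi)=V(\sigma,\varphi)\rightarrow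 V(\sigma,\psi)$; $V(\sigma,\boxdot\varphi)=\big(\inf_{i\ge0}V_1(\sigma_{i..},\varphi),\sup_{j\ge0}\inf_{i\ge j}V_2(\sigma_{i..},\varphi),\inf_{j\ge0}\sup_{i\ge j}V_3(\sigma_{i..},\varphi),\sup_{i\ge0}V_4(\sigma_{i..},\varphi)\big)$; $V(\sigma,\dot{\Diamond}\varphi)=(\sup_{i\ge0}V_k(\sigma_{i..},\varphi))_{k=1..4}$. $\mathrm{cl}(\varphi)$ is the set of subformulas of $\varphi$. A generalized Büchi automaton over $\Sigma$ has a finite state set $Q$, transition relation $\Delta\subseteq Q\times\Sigma\times Q$ and a set $\mathcal F\subseteq 2^Q$ of acceptance sets; a run on $\sigma$ from $q$ is $q_0q_1\cdots$ with $q_0=q$ and $(q_i,\sigma(i),q_{i+1})\in\Delta$; it is accepting if it visits each $F\in\mathcal F$ infinitely often. Definition of $\mathcal A_\varphi=(Q,\Sigma,\Delta,\mathcal F)$ (no initial state): let $S$ be the set of maps $\mu:\mathrm{cl}(\varphi)\to\mathbb B_4$ such that for all $\psi\in\mathrm{cl}(\varphi)$: if $\psi=p$ then $\mu(p)\in\{0000,1111\}$; if $\psi=\neg\psi_1$ then $\mu(\psi)=\overline{\mu(\psi_1)}$; if $\psi=\psi_1\land\psi_2$ then $\mu(\psi)=\min\{\mu(\psi_1),\mu(\psi_2)\}$; if $\psi=\psi_1\lor\psi_2$ then $\mu(\psi)=\max\{\mu(\psi_1),\mu(\psi_2)\}$; if $\psi=\psi_1\Rightarrow\psi_2$ then $\mu(\psi)=\mu(\psi_1)\rightarrow\mu(\psi_2)$.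 Let $Q=\{q_b\mid b\in\mathbb B_4\}\cup S$. For $a\in\Sigma$ say $\mu$ matches $a$ if $\mu(p)=1111$ for $p\in a\cap\mathrm{cl}(\varphi)$ and $\mu(p)=0000$ for $p\in\mathrm{cl}(\varphi)\setminus a$. Transitions: $(q_b,a,\mu)\in\Delta$ iff $\mu(\varphi)=b$ and $\mu$ matches $a$; $(\mu,a,\mu')\in\Delta$ (for $\mu,\mu'\in S$) iff $\mu'$ matches $a$ and for every $\dot{\Diamond}\psi\in\mathrm{cl}(\varphi)$, $\pi_j(\mu(\dot{\Diamond}\psi))=\max\{\pi_j(\mu(\psi)),\pi_j(\mu'(\dot{\Diamond}\psi))\}$ for $j=1..4$, and for every $\boxdot\psi\in\mathrm{cl}(\varphi)$, $\mu(\boxdot\psi)=(b_1,b_2,b_3,b_4)$ with $b_1=\min\{\pi_1(\mu(\psi)),\pi_1(\mu'(\boxdot\psi))\}$, $b_2=\max\{b_1,\pi_2(\mu'(\boxdot\psi))\}$, $b_3=\min\{b_4,\pi_3(\mu'(\boxdot\psi))\}$, $b_4=\max\{\pi_4(\mu(\psi)),\pi_4(\mu'(\boxdot\psi))\}$. Acceptance sets: for each $\dot{\Diamond}\psi\in\mathrm{cl}(\varphi)$ and $j\in\{1..4\}$, $F_{\dot{\Diamond}\psi,j}=\{\mu\in S\mid\pi_j(\mu(\dot{\Diamond}\psi))=0\text{ or }\pi_j(\mu(\psi))=1\}$; for each $\boxdot\psi\in\mathrm{cl}(\varphi)$: $F_{\boxdot\psi,1}=\{\mu\in S\mid\pi_1(\mu(\boxdot\psi))=1\text{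 or }\pi_1(\mu(\psi))=0\}$, $F_{\boxdot\psi,2}=\{\mu\mid\pi_2(\mu(\boxdot\psi))=0\text{ or }\pi_1(\mu(\boxdot\psi))=1\}$, $F_{\boxdot\psi,3}=\{\mu\mid\pi_3(\mu(\boxdot\psi))=1\text{ or }\pi_4(\mu(\boxdot\psi))=0\}$, $F_{\boxdot\psi,4}=\{\mu\mid\pi_4(\mu(\boxdot\psi))=0\text{ or }\pi_4(\mu(\psi))=1\}$; $\mathcal F$ is the collection of all these sets. -}

module Defs where

open import Data.Nat using (ℕ; zero; suc; _+_; _≤ᵇ_) renaming (_≤_ to _≤ℕ_)
open import Data.Bool using (Bool; true; false; _∧_; _∨_; if_then_else_; _≤_)
open import Data.Fin using (Fin; zero; suc)
open import Data.Fin.Subset using (Subset)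
open import Data.Vec using (lookup)
open import Data.Product using (Σ; ∃; _×_; _,_)
open import Data.Sum using (_⊎_)
open import Data.Empty using (⊥)
open import Data.Unit using (⊤)
open import Function using (_∘_)
open import Relation.Binary.PropositionalEquality using (_≡_)

data B4 : Set where
  b0000 b0001 b0011 b0111 b1111 : B4

π₁ π₂ π₃ π₄ : B4 → Bool
π₁ b1111 = true
π₁ _     = false
π₂ b0111 = true
π₂ b1111 = true
π₂ _     = false
π₃ b0000 = false
π₃ b0001 = false
π₃ _     = true
π₄ b0000 = false
π₄ _     = true

-- π k is the (k+1)-th coordinate projection (Fin 4 is 0-based)
π : Fin 4 → B4 → Bool
π zero                   = π₁
π (suc zero)             = π₂
π (suc (suc zero))       = π₃
π (suc (suc (suc zero))) = π₄

rank : B4 → ℕ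
rank b0000 = 0
rank b0001 = 1
rank b0011 = 2
rank b0111 = 3
rank b1111 = 4

min4 : B4 → B4 → B4
min4 a b = if rank a ≤ᵇ rank b then a else b

max4 : B4 → B4 → B4
max4 a b = if rank a ≤ᵇ rank b then b else a

neg4 : B4 → B4
neg4 b1111 = b0000
neg4 _     = b1111

imp4 : B4 → B4 → B4
imp4 a b = if rank a ≤ᵇ rank b then b1111 else b

infixr 6 _∧ᶠ_
infixr 5 _∨ᶠ_
infixr 4 _⇒ᶠ_

data Formula (n : ℕ) : Set where
  atom  : Fin n → Formula n
  ¬ᶠ_   : Formula n → Formula n
  _∨ᶠ_  : Formula n → Formula n → Formula n
  _∧ᶠ_  : Formula n → Formula n → Formula n
  _⇒ᶠ_  : Formula n → Formula n → Formula n
  box   : Formula n → Formula n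
  dia   : Formula n → Formula n

data _⊑_ {n : ℕ} : Formula n → Formula n → Set where
  ⊑-refl : ∀ {φ} → φ ⊑ φ
  ⊑-¬    : ∀ {ψ φ} → ψ ⊑ φ → ψ ⊑ (¬ᶠ φ)
  ⊑-∨ˡ   : ∀ {ψ φ χ} → ψ ⊑ φ → ψ ⊑ (φ ∨ᶠ χ)
  ⊑-∨ʳ   : ∀ {ψ φ χ} → ψ ⊑ χ → ψ ⊑ (φ ∨ᶠ χ)
  ⊑-∧ˡ   : ∀ {ψ φ χ} → ψ ⊑ φ → ψ ⊑ (φ ∧ᶠ χ)
  ⊑-∧ʳ   : ∀ {ψ φ χ} → ψ ⊑ χ → ψ ⊑ (φ ∧ᶠ χ)
  ⊑-⇒ˡ   : ∀ {ψ φ χ} → ψ ⊑ φ → ψ ⊑ (φ ⇒ᶠ χ)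
  ⊑-⇒ʳ   : ∀ {ψ φ χ} → ψ ⊑ χ → ψ ⊑ (φ ⇒ᶠ χ)
  ⊑-box  : ∀ {ψ φ} → ψ ⊑ φ → ψ ⊑ box φ
  ⊑-dia  : ∀ {ψ φ} → ψ ⊑ φ → ψ ⊑ dia φ

Sym : ℕ → Set
Sym = Subset

Word : ℕ → Set
Word n = ℕ → Sym n

suffix : ∀ {n} → ℕ → Word n → Word n
suffix i σ k = σ (i + k)

atomVal : ∀ {n} → Sym n → Fin n → B4
atomVal a p = if lookup a p then b1111 else b0000

IsInf : (ℕ → Bool) → Bool → Set
IsInf g x = (∀ i → x ≤ g i) × (∀ y → (∀ i → y ≤ g i) → y ≤ x)

IsSup : (ℕ → Bool) → Bool → Set
IsSup g x = (∀ i → g i ≤ x) × (∀ y → (∀ i → g i ≤ y) → x ≤ y)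

IsSupInf : (ℕ → Bool) → Bool → Set
IsSupInf g x = Σ (ℕ → Bool) λ h → (∀ j → IsInf (λ k → g (j + k)) (h j)) × IsSup h x

IsInfSup : (ℕ → Bool) → Bool → Set
IsInfSup g x = Σ (ℕ → Bool) λ h → (∀ j → IsSup (λ k → g (j + k)) (h j)) × IsInf h x

-- The valuation, as a relation:  Val φ σ b  means  V(σ, φ) = b

Val : ∀ {n} → Formula n → Word n → B4 → Set
Val (atom p) σ b = b ≡ atomVal (σ 0) p
Val (¬ᶠ φ) σ b = Σ B4 λ a → Val φ σ a × b ≡ neg4 a
Val (φ ∨ᶠ ψ) σ b = Σ B4 λ a → Σ B4 λ c → Val φ σ a × Val ψ σ c × b ≡ max4 a c
Val (φ ∧ᶠ ψ) σ b = Σ B4 λ a → Σ B4 λ c → Val φ σ a × Val ψ σ c × b ≡ min4 a c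
Val (φ ⇒ᶠ ψ) σ b = Σ B4 λ a → Σ B4 λ c → Val φ σ a × Val ψ σ c × b ≡ imp4 a c
Val (box φ) σ b = Σ (ℕ → B4) λ f → (∀ i → Val φ (suffix i σ) (f i))
  × IsInf (π₁ ∘ f) (π₁ b) × IsSupInf (π₂ ∘ f) (π₂ b)
  × IsInfSup (π₃ ∘ f) (π₃ b) × IsSup (π₄ ∘ f) (π₄ b)
Val (dia φ) σ b = Σ (ℕ → B4) λ f → (∀ i → Val φ (suffix i σ) (f i))
  × (∀ k → IsSup (π k ∘ f) (π k b))

module _ {n : ℕ} (φ : Formula n) where

  Local : (Formula n → B4) → Formula n → Set
  Local μ (atom p) = μ (atom p) ≡ b0000 ⊎ μ (atom p) ≡ b1111
  Local μ (¬ᶠ ψ) = μ (¬ᶠ ψ) ≡ neg4 (μ ψ)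
  Local μ (ψ ∨ᶠ χ) = μ (ψ ∨ᶠ χ) ≡ max4 (μ ψ) (μ χ)
  Local μ (ψ ∧ᶠ χ) = μ (ψ ∧ᶠ χ) ≡ min4 (μ ψ) (μ χ)
  Local μ (ψ ⇒ᶠ χ) = μ (ψ ⇒ᶠ χ) ≡ imp4 (μ ψ) (μ χ)
  Local μ (box ψ) = ⊤
  Local μ (dia ψ) = ⊤

  -- μ ∈ S (only the values of μ on cl(φ) matter)
  InS : (Formula n → B4) → Set
  InS μ = ∀ ψ → ψ ⊑ φ → Local μ ψ

  data Q : Set where
    init : B4 → Q
    st   : (μ : Formula n → B4) → InS μ → Q

  Matches : (Formula n → B4) → Sym n → Set
  Matches μ a = ∀ p → atom p ⊑ φ → μ (atom p) ≡ atomVal a p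

  DiaStep : (Formula n → B4) → (Formula n → B4) → Formula n → Set
  DiaStep μ μ' ψ = ∀ j → π j (μ (dia ψ)) ≡ (π j (μ ψ) ∨ π j (μ' (dia ψ)))

  BoxStep : (Formula n → B4) → (Formula n → B4) → Formula n → Set
  BoxStep μ μ' ψ =
    π₁ (μ (box ψ)) ≡ b1 × π₂ (μ (box ψ)) ≡ b2 × π₃ (μ (box ψ)) ≡ b3 × π₄ (μ (box ψ)) ≡ b4
    where
      b1 = π₁ (μ ψ) ∧ π₁ (μ' (box ψ))
      b4 = π₄ (μ ψ) ∨ π₄ (μ' (box ψ))
      b2 = b1 ∨ π₂ (μ' (box ψ))
      b3 = b4 ∧ π₃ (μ' (box ψ))

  Δ : Q → Sym n → Q → Set
  Δ (init b) a (init _) = ⊥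
  Δ (init b) a (st μ _) = μ φ ≡ b × Matches μ a
  Δ (st _ _) a (init _) = ⊥
  Δ (st μ _) a (st μ' _) = Matches μ' a
    × (∀ ψ → dia ψ ⊑ φ → DiaStep μ μ' ψ)
    × (∀ ψ → box ψ ⊑ φ → BoxStep μ μ' ψ)

  -- index set of the acceptance family 𝓕 (j : Fin 4 is 0-based)
  data AccIdx : Set where
    diaF : (ψ : Formula n) → dia ψ ⊑ φ → Fin 4 → AccIdx
    boxF : (ψ : Formula n) → box ψ ⊑ φ → Fin 4 → AccIdx

  onS : ((Formula n → B4) → Set) → Q → Set
  onS P (init _) = ⊥
  onS P (st μ _) = P μ

  BoxF : Formula n → Fin 4 → (Formula n → B4) → Set
  BoxF ψ zero μ = π₁ (μ (box ψ)) ≡ true ⊎ π₁ (μ ψ) ≡ false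
  BoxF ψ (suc zero) μ = π₂ (μ (box ψ)) ≡ false ⊎ π₁ (μ (box ψ)) ≡ true
  BoxF ψ (suc (suc zero)) μ = π₃ (μ (box ψ)) ≡ true ⊎ π₄ (μ (box ψ)) ≡ false
  BoxF ψ (suc (suc (suc zero))) μ = π₄ (μ (box ψ)) ≡ false ⊎ π₄ (μ ψ) ≡ true

  InF : AccIdx → Q → Set
  InF (diaF ψ _ j) = onS λ μ → π j (μ (dia ψ)) ≡ false ⊎ π j (μ ψ) ≡ true
  InF (boxF ψ _ j) = onS (BoxF ψ j)

  IsRun : Word n → Q → (ℕ → Q) → Set
  IsRun σ q r = r 0 ≡ q × (∀ i → Δ (r i) (σ i) (r (suc i)))

  InfOften : (Q → Set) → (ℕ → Q) → Set
  InfOften F r = ∀ i → ∃ λ k → i ≤ℕ k × F (r k)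

  Accepting : (ℕ → Q) → Set
  Accepting r = ∀ F → InfOften (InF F) r

  AcceptsFrom : Word n → Q → Set
  AcceptsFrom σ q = Σ (ℕ → Q) λ r → IsRun σ q r × Accepting r

module Submission where

-- A truth value of 𝔹₄ is an ascending vector of four bits, hence determined by
-- the four propositions its coordinates reflect (Coords).  Using excluded
-- middle, every formula ψ gets a canonical valuation v ψ i at each instant i
-- of σ; at ⊡ψ and ◇̇ψ its coordinates reflect □, ◇□, □◇, ◇ (resp. ◇ four times)
-- of the coordinate streams of ψ.  After general facts on booleans, 𝔹₄, infima
-- and suprema (Val is functional) and the operators □, ◇ on predicates over ℕ:
--   * every formula is ultimately "paired" (valued in 0000, 0011, 1111), which
--     lets ◇□ (□◇) of the first (fourth) coordinate replace that of the second
--     (third), as the transition constraints of 𝒜_φ at ⊡ψ presuppose;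
--   * the canonical streams satisfy the transition constraints (one-step
--     unfoldings of the operators) and the acceptance conditions of 𝒜_φ;
--   * conversely, a stream satisfying the constraints and the acceptance
--     conditions is the least (◇) or greatest (□) fixpoint of its unfolding,
--     i.e. the canonical stream.
-- Completeness labels the run by v; soundness shows, by induction on
-- subformulas, that the labels of an accepting run are v, and v computes Val.

open import Defs
open import Level using (0ℓ)
open import Data.Nat using (ℕ; zero; suc; _+_; _∸_; _⊔_; _≤ᵇ_; z≤n; s≤s) renaming (_≤_ to _≤ℕ_)
open import Data.Nat.Properties
  using (≤-refl; ≤-trans; m≤m+n; m+[n∸m]≡n; +-assoc; +-identityʳ; n≤1+n; m≤n⇒m≤1+n;
         m≤m⊔n; m≤n⊔m; m≤n⇒m<n∨m≡n)
open import Data.Bool using (Bool; true; false; _∧_; _∨_; b≤b; f≤t) renaming (_≤_ to _≤ᴮ_)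
open import Data.Bool.Properties using (¬-not; ∨-zeroʳ) renaming (≤-antisym to ≤ᴮ-antisym)
open import Data.Fin using (zero; suc)
open import Data.Vec using (lookup)
open import Data.Product using (∃; _×_; _,_; proj₁; proj₂)
open import Data.Sum using (_⊎_; inj₁; inj₂; [_,_]; swap)
open import Data.Empty using (⊥; ⊥-elim)
open import Data.Unit using (tt)
open import Function using (_∘_; id)
open import Function.Bundles using (_⇔_; mk⇔; Equivalence)
open import Function.Construct.Symmetry using (⇔-sym)
open import Axiom.ExcludedMiddle using (ExcludedMiddle)
open import Relation.Nullary using (¬_; yes; no; does; proof)
open import Relation.Nullary.Decidable using (decidable-stable)
open import Relation.Nullary.Reflects using (Reflects; ofʸ; ofⁿ; det; _×-reflects_; _⊎-reflects_)
open import Relation.Unary using (Pred; _⊆_; _⇒_; _∩_; ∁)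
open import Relation.Binary.PropositionalEquality
  using (_≡_; refl; sym; trans; cong; cong₂; subst)

open Equivalence using (to; from)

variable
  A B A₁ A₂ A₃ A₄ : Set
  x y b c : Bool
  P R : Pred ℕ 0ℓ
  i : ℕ

reflects-true : Reflects A b → b ≡ true → A
reflects-true (ofʸ a) _ = a

true-by : Reflects A b → A → b ≡ true
true-by (ofʸ _)  _ = refl
true-by (ofⁿ ¬a) a = ⊥-elim (¬a a)

false-by : Reflects A b → ¬ A → b ≡ false
false-by (ofʸ a) ¬a = ⊥-elim (¬a a)
false-by (ofⁿ _) _  = refl

reflects-⇔ : A ⇔ B → Reflects A b → Reflects B b
reflects-⇔ e (ofʸ a)  = ofʸ (to e a)
reflects-⇔ e (ofⁿ ¬a) = ofⁿ (¬a ∘ from e)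

≡true-reflects : ∀ b → Reflects (b ≡ true) b
≡true-reflects true  = ofʸ refl
≡true-reflects false = ofⁿ λ ()

false≢true : ¬ (false ≡ true)
false≢true ()

reflects-intro : (b ≡ true → A) → (A → b ≡ true) → Reflects A b
reflects-intro {b = true}  f _ = ofʸ (f refl)
reflects-intro {b = false} _ h = ofⁿ (false≢true ∘ h)

det-⇔ : A ⇔ B → Reflects A x → Reflects B y → x ≡ y
det-⇔ e r r′ = det (reflects-⇔ e r) r′

reflects-implication : (A → B) → Reflects A x → Reflects B y → x ≡ false ⊎ y ≡ true
reflects-implication _  (ofⁿ _) _ = inj₁ refl
reflects-implication AB (ofʸ a) r = inj₂ (true-by r (AB a))

∧-true : x ∧ y ≡ true → x ≡ true × y ≡ true
∧-true {true}  {true}  _  = refl , refl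
∧-true {true}  {false} ()
∧-true {false}         ()

⟦_⟧ : (ℕ → Bool) → Pred ℕ 0ℓ
⟦ g ⟧ k = g k ≡ true

π₁⇒π₂ : ∀ a → π₁ a ≡ true → π₂ a ≡ true
π₁⇒π₂ b1111 _ = refl

π₂⇒π₃ : ∀ a → π₂ a ≡ true → π₃ a ≡ true
π₂⇒π₃ b0111 _ = refl
π₂⇒π₃ b1111 _ = refl

π₃⇒π₄ : ∀ a → π₃ a ≡ true → π₄ a ≡ true
π₃⇒π₄ b0011 _ = refl
π₃⇒π₄ b0111 _ = refl
π₃⇒π₄ b1111 _ = refl

fromBits : Bool → Bool → Bool → Bool → B4
fromBits true  _     _     _     = b1111
fromBits false true  _     _     = b0111
fromBits false false true  _     = b0011
fromBits false false false true  = b0001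
fromBits false false false false = b0000

fromBits-π : ∀ a → fromBits (π₁ a) (π₂ a) (π₃ a) (π₄ a) ≡ a
fromBits-π b0000 = refl
fromBits-π b0001 = refl
fromBits-π b0011 = refl
fromBits-π b0111 = refl
fromBits-π b1111 = refl

π-injective : ∀ {a c} → π₁ a ≡ π₁ c → π₂ a ≡ π₂ c → π₃ a ≡ π₃ c → π₄ a ≡ π₄ c → a ≡ c
π-injective {a} {c} e₁ e₂ e₃ e₄ =
  trans (sym (fromBits-π a))
    (trans (cong₂ (λ u w → fromBits u w (π₃ a) (π₄ a)) e₁ e₂)
      (trans (cong₂ (fromBits (π₁ c) (π₂ c)) e₃ e₄) (fromBits-π c)))

record Coords (a : B4) (A₁ A₂ A₃ A₄ : Set) : Set where
  constructor coords
  field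
    coord₁ : Reflects A₁ (π₁ a)
    coord₂ : Reflects A₂ (π₂ a)
    coord₃ : Reflects A₃ (π₃ a)
    coord₄ : Reflects A₄ (π₄ a)
open Coords

coords-unique : ∀ {a c} → Coords a A₁ A₂ A₃ A₄ → Coords c A₁ A₂ A₃ A₄ → a ≡ c
coords-unique ca cc =
  π-injective (det (coord₁ ca) (coord₁ cc)) (det (coord₂ ca) (coord₂ cc))
              (det (coord₃ ca) (coord₃ cc)) (det (coord₄ ca) (coord₄ cc))

fromBits-coords : ∀ {b₁ b₂ b₃ b₄} → Reflects A₁ b₁ → Reflects A₂ b₂ → Reflects A₃ b₃ → Reflects A₄ b₄
                → (A₁ → A₂) → (A₂ → A₃) → (A₃ → A₄) → Coords (fromBits b₁ b₂ b₃ b₄) A₁ A₂ A₃ A₄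
fromBits-coords r₁@(ofʸ _) r₂@(ofʸ _) r₃@(ofʸ _) r₄@(ofʸ _) _ _ _ = coords r₁ r₂ r₃ r₄
fromBits-coords r₁@(ofⁿ _) r₂@(ofʸ _) r₃@(ofʸ _) r₄@(ofʸ _) _ _ _ = coords r₁ r₂ r₃ r₄
fromBits-coords r₁@(ofⁿ _) r₂@(ofⁿ _) r₃@(ofʸ _) r₄@(ofʸ _) _ _ _ = coords r₁ r₂ r₃ r₄
fromBits-coords r₁@(ofⁿ _) r₂@(ofⁿ _) r₃@(ofⁿ _) r₄@(ofʸ _) _ _ _ = coords r₁ r₂ r₃ r₄
fromBits-coords r₁@(ofⁿ _) r₂@(ofⁿ _) r₃@(ofⁿ _) r₄@(ofⁿ _) _ _ _ = coords r₁ r₂ r₃ r₄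
fromBits-coords (ofʸ a₁) (ofⁿ ¬a₂) _ _ m₁ _ _ = ⊥-elim (¬a₂ (m₁ a₁))
fromBits-coords _ (ofʸ a₂) (ofⁿ ¬a₃) _ _ m₂ _ = ⊥-elim (¬a₃ (m₂ a₂))
fromBits-coords _ _ (ofʸ a₃) (ofⁿ ¬a₄) _ _ m₃ = ⊥-elim (¬a₄ (m₃ a₃))

-- The paired truth values 0000, 0011, 1111: the first two and the last two
-- coordinates agree.  Every formula ultimately takes only paired values.
Paired : B4 → Set
Paired a = π₁ a ≡ π₂ a × π₃ a ≡ π₄ a

paired-0000 : Paired b0000
paired-0000 = refl , refl

paired-1111 : Paired b1111
paired-1111 = refl , refl

paired-either : ∀ {a c d} → d ≡ a ⊎ d ≡ c → Paired a → Paired c → Paired d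
paired-either (inj₁ refl) pa _ = pa
paired-either (inj₂ refl) _ pc = pc

atomVal-cases : ∀ {n} (a : Sym n) p → atomVal a p ≡ b0000 ⊎ atomVal a p ≡ b1111
atomVal-cases a p with lookup a p
... | true  = inj₂ refl
... | false = inj₁ refl

neg4-cases : ∀ a → neg4 a ≡ b0000 ⊎ neg4 a ≡ b1111
neg4-cases b1111 = inj₁ refl
neg4-cases b0000 = inj₂ refl
neg4-cases b0001 = inj₂ refl
neg4-cases b0011 = inj₂ refl
neg4-cases b0111 = inj₂ refl

min4-selective : ∀ a c → min4 a c ≡ a ⊎ min4 a c ≡ c
min4-selective a c with rank a ≤ᵇ rank c
... | true  = inj₁ refl
... | false = inj₂ refl

max4-selective : ∀ a c → max4 a c ≡ c ⊎ max4 a c ≡ a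
max4-selective a c with rank a ≤ᵇ rank c
... | true  = inj₁ refl
... | false = inj₂ refl

imp4-cases : ∀ a c → imp4 a c ≡ b1111 ⊎ imp4 a c ≡ c
imp4-cases a c with rank a ≤ᵇ rank c
... | true  = inj₁ refl
... | false = inj₂ refl

≤ᴮ-intro : (x ≡ true → y ≡ true) → x ≤ᴮ y
≤ᴮ-intro {false} {false} _ = b≤b
≤ᴮ-intro {false} {true}  _ = f≤t
≤ᴮ-intro {true}  {true}  _ = b≤b
≤ᴮ-intro {true}  {false} h with h refl
... | ()

≤ᴮ-elim : x ≤ᴮ y → x ≡ true → y ≡ true
≤ᴮ-elim b≤b t = t

inf-unique : ∀ {g g' : ℕ → Bool} → (∀ k → g k ≡ g' k) → IsInf g x → IsInf g' y → x ≡ y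
inf-unique {x = x} {y} e (lb , glb) (lb' , glb') =
  ≤ᴮ-antisym (glb' x λ k → subst (x ≤ᴮ_) (e k) (lb k)) (glb y λ k → subst (y ≤ᴮ_) (sym (e k)) (lb' k))

sup-unique : ∀ {g g' : ℕ → Bool} → (∀ k → g k ≡ g' k) → IsSup g x → IsSup g' y → x ≡ y
sup-unique {x = x} {y} e (ub , lub) (ub' , lub') =
  ≤ᴮ-antisym (lub y λ k → subst (_≤ᴮ y) (sym (e k)) (ub' k)) (lub' x λ k → subst (_≤ᴮ x) (e k) (ub k))

supInf-unique : ∀ {g g' : ℕ → Bool} → (∀ k → g k ≡ g' k) → IsSupInf g x → IsSupInf g' y → x ≡ y
supInf-unique e (h , I , S) (h' , I' , S') =
  sup-unique (λ j → inf-unique (λ k → e (j + k)) (I j) (I' j)) S S'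

infSup-unique : ∀ {g g' : ℕ → Bool} → (∀ k → g k ≡ g' k) → IsInfSup g x → IsInfSup g' y → x ≡ y
infSup-unique e (h , S , I) (h' , S' , I') =
  inf-unique (λ j → sup-unique (λ k → e (j + k)) (S j) (S' j)) I I'

Val-functional : ∀ {n} (ψ : Formula n) {τ a c} → Val ψ τ a → Val ψ τ c → a ≡ c
Val-functional (atom p) ea ec = trans ea (sym ec)
Val-functional (¬ᶠ ψ) (_ , va , ea) (_ , vc , ec) =
  trans ea (trans (cong neg4 (Val-functional ψ va vc)) (sym ec))
Val-functional (ψ ∨ᶠ χ) (_ , _ , va , va' , ea) (_ , _ , vc , vc' , ec) =
  trans ea (trans (cong₂ max4 (Val-functional ψ va vc) (Val-functional χ va' vc')) (sym ec))
Val-functional (ψ ∧ᶠ χ) (_ , _ , va , va' , ea) (_ , _ , vc , vc' , ec) =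
  trans ea (trans (cong₂ min4 (Val-functional ψ va vc) (Val-functional χ va' vc')) (sym ec))
Val-functional (ψ ⇒ᶠ χ) (_ , _ , va , va' , ea) (_ , _ , vc , vc' , ec) =
  trans ea (trans (cong₂ imp4 (Val-functional ψ va vc) (Val-functional χ va' vc')) (sym ec))
Val-functional (box ψ) (f , vf , i₁ , s₂ , s₃ , s₄) (f' , vf' , i₁' , s₂' , s₃' , s₄') =
  π-injective (inf-unique (same π₁) i₁ i₁') (supInf-unique (same π₂) s₂ s₂')
              (infSup-unique (same π₃) s₃ s₃') (sup-unique (same π₄) s₄ s₄')
  where
    same : ∀ (πₖ : B4 → Bool) k → πₖ (f k) ≡ πₖ (f' k)
    same πₖ k = cong πₖ (Val-functional ψ (vf k) (vf' k))
Val-functional (dia ψ) {a = a} {c} (f , vf , s) (f' , vf' , s') =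
  π-injective (coordinate zero) (coordinate (suc zero))
              (coordinate (suc (suc zero))) (coordinate (suc (suc (suc zero))))
  where
    coordinate : ∀ j → π j a ≡ π j c
    coordinate j = sup-unique (λ k → cong (π j) (Val-functional ψ (vf k) (vf' k))) (s j) (s' j)

□ ◇ : Pred ℕ 0ℓ → Pred ℕ 0ℓ
□ P i = ∀ x → i ≤ℕ x → P x
◇ P i = ∃ λ x → i ≤ℕ x × P x

InfinitelyOften : Pred ℕ 0ℓ → Set
InfinitelyOften P = ∀ i → ◇ P i

Ultimately : Pred ℕ 0ℓ → Set
Ultimately P = ∃ λ N → □ P N

□-now : □ P i → P i
□-now h = h _ ≤-refl

◇-now : P i → ◇ P i
◇-now p = _ , ≤-refl , p

□-later : ∀ {j} → i ≤ℕ j → □ P i → □ P j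
□-later ij h x jx = h x (≤-trans ij jx)

◇-earlier : ∀ {j} → i ≤ℕ j → ◇ P j → ◇ P i
◇-earlier ij (x , jx , p) = x , ≤-trans ij jx , p

□-map : P ⊆ R → □ P ⊆ □ R
□-map PR h x ix = PR (h x ix)

◇-map : P ⊆ R → ◇ P ⊆ ◇ R
◇-map PR (x , ix , p) = x , ix , PR p

◇-map-from : □ (P ⇒ R) i → ◇ P i → ◇ R i
◇-map-from h (x , ix , p) = x , ix , h x ix p

□-induction : (∀ k → i ≤ℕ k → P k → P (suc k)) → P i → □ P i
□-induction step p zero z≤n = p
□-induction step p (suc x) ix with m≤n⇒m<n∨m≡n ix
... | inj₂ refl      = p
... | inj₁ (s≤s ix') = step x ix' (□-induction step p x ix')

◇-backward : (∀ k → P (suc k) → P k) → ◇ P i → P i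
◇-backward {P = P} {i} back (x , ix , p) = □-induction {P = λ k → P k → P i} (λ k _ q → q ∘ back k) id x ix p

□-unfold : □ P i ⇔ (P i × □ P (suc i))
□-unfold = mk⇔ (λ h → □-now h , □-later (n≤1+n _) h) fold
  where
    fold : P i × □ P (suc i) → □ P i
    fold (p , h) x ix with m≤n⇒m<n∨m≡n ix
    ... | inj₂ refl = p
    ... | inj₁ i<x  = h x i<x

◇-unfold : ◇ P i ⇔ (P i ⊎ ◇ P (suc i))
◇-unfold = mk⇔ unfold [ ◇-now , ◇-earlier (n≤1+n _) ]
  where
    unfold : ◇ P i → P i ⊎ ◇ P (suc i)
    unfold (x , ix , p) with m≤n⇒m<n∨m≡n ix
    ... | inj₂ refl = inj₁ p
    ... | inj₁ i<x  = inj₂ (x , i<x , p)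

◇□-unfold : R ⊆ P → ◇ (□ P) i ⇔ (□ R i ⊎ ◇ (□ P) (suc i))
◇□-unfold RP = mk⇔ (λ (a , ia , h) → inj₂ (suc a , s≤s ia , □-later (n≤1+n a) h))
                   [ (λ h → ◇-now (□-map RP h)) , ◇-earlier (n≤1+n _) ]

□◇-unfold : P ⊆ R → □ (◇ P) i ⇔ (◇ R i × □ (◇ P) (suc i))
□◇-unfold PR = mk⇔ (λ h → ◇-map PR (□-now h) , □-later (n≤1+n _) h)
                   (λ (_ , h) → from □-unfold (◇-earlier (n≤1+n _) (□-now h) , h))

◇□⊆□◇ : ◇ (□ P) ⊆ □ (◇ P)
◇□⊆□◇ (a , _ , h) x _ = a ⊔ x , m≤n⊔m a x , h (a ⊔ x) (m≤m⊔n a x)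

□-offset : (∀ k → P (i + k)) ⇔ □ P i
□-offset {P = P} {i} = mk⇔ (λ h x ix → subst P (m+[n∸m]≡n ix) (h (x ∸ i))) (λ h k → h (i + k) (m≤m+n i k))

◇-offset : (∃ λ k → P (i + k)) ⇔ ◇ P i
◇-offset {P = P} {i} = mk⇔ (λ (k , p) → i + k , m≤m+n i k , p)
                           (λ (x , ix , p) → x ∸ i , subst P (sym (m+[n∸m]≡n ix)) p)

□-offset₂ : ∀ {j} → □ P (i + j) ⇔ (∀ k → P (i + (j + k)))
□-offset₂ {P = P} {i} {j} = mk⇔ (λ h k → subst P (+-assoc i j k) (from □-offset h k))
                                (λ h → to □-offset λ k → subst P (sym (+-assoc i j k)) (h k))

◇-offset₂ : ∀ {j} → ◇ P (i + j) ⇔ (∃ λ k → P (i + (j + k)))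
◇-offset₂ {P = P} {i} {j} = mk⇔ (λ e → let (k , p) = from ◇-offset e in k , subst P (+-assoc i j k) p)
                                (λ (k , p) → to ◇-offset (k , subst P (sym (+-assoc i j k)) p))

ultimately-map : P ⊆ R → Ultimately P → Ultimately R
ultimately-map PR (N , h) = N , □-map PR h

ultimately-∩ : Ultimately P → Ultimately R → Ultimately (P ∩ R)
ultimately-∩ (M , p) (N , r) = M ⊔ N , λ x le → p x (≤-trans (m≤m⊔n M N) le) , r x (≤-trans (m≤n⊔m M N) le)

◇□-map-ultimately : Ultimately (P ⇒ R) → ◇ (□ P) ⊆ ◇ (□ R)
◇□-map-ultimately (N , h) (a , ia , p) =
  a ⊔ N , ≤-trans ia (m≤m⊔n a N) , λ x le → h x (≤-trans (m≤n⊔m a N) le) (p x (≤-trans (m≤m⊔n a N) le))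

□◇-map-ultimately : Ultimately (P ⇒ R) → □ (◇ P) ⊆ □ (◇ R)
□◇-map-ultimately (N , h) p x ix with p (x ⊔ N) (≤-trans ix (m≤m⊔n x N))
... | y , le , py = y , ≤-trans (m≤m⊔n x N) le , h y (≤-trans (m≤n⊔m x N) le) py

◇-ultimately-⇔ : P ⊆ R → Ultimately (R ⇒ P) → Ultimately (λ x → ◇ P x ⇔ ◇ R x)
◇-ultimately-⇔ PR (N , RP) = N , λ x Nx → mk⇔ (◇-map PR) (◇-map-from (□-later Nx RP))

ultimately⇒infinitely : Ultimately P → InfinitelyOften P
ultimately⇒infinitely (N , h) i = i ⊔ N , m≤m⊔n i N , h (i ⊔ N) (m≤n⊔m i N)

ascending₁₂ : ∀ (f : ℕ → B4) → ⟦ π₁ ∘ f ⟧ ⊆ ⟦ π₂ ∘ f ⟧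
ascending₁₂ f {x} = π₁⇒π₂ (f x)

ascending₂₃ : ∀ (f : ℕ → B4) → ⟦ π₂ ∘ f ⟧ ⊆ ⟦ π₃ ∘ f ⟧
ascending₂₃ f {x} = π₂⇒π₃ (f x)

ascending₃₄ : ∀ (f : ℕ → B4) → ⟦ π₃ ∘ f ⟧ ⊆ ⟦ π₄ ∘ f ⟧
ascending₃₄ f {x} = π₃⇒π₄ (f x)

paired₂⇒₁ : ∀ {f : ℕ → B4} → Ultimately (Paired ∘ f) → Ultimately (⟦ π₂ ∘ f ⟧ ⇒ ⟦ π₁ ∘ f ⟧)
paired₂⇒₁ = ultimately-map λ (e , _) → trans e

paired₄⇒₃ : ∀ {f : ℕ → B4} → Ultimately (Paired ∘ f) → Ultimately (⟦ π₄ ∘ f ⟧ ⇒ ⟦ π₃ ∘ f ⟧)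
paired₄⇒₃ = ultimately-map λ (_ , e) → trans e

reflected-⊆ : ∀ {g : ℕ → Bool} → (∀ k → Reflects (P k) (g k)) → ⟦ g ⟧ ⊆ P
reflected-⊆ r {k} = reflects-true (r k)

reflecting-⊆ : ∀ {g : ℕ → Bool} → (∀ k → Reflects (P k) (g k)) → P ⊆ ⟦ g ⟧
reflecting-⊆ r {k} = true-by (r k)

⟦⟧-cong : ∀ {g h : ℕ → Bool} → (∀ k → g k ≡ h k) → ⟦ g ⟧ ⊆ ⟦ h ⟧
⟦⟧-cong e {k} = trans (sym (e k))

monotone-⇔ : (O : Pred ℕ 0ℓ → Pred ℕ 0ℓ) → (∀ {P R} → P ⊆ R → O P ⊆ O R)
           → ∀ {g h : ℕ → Bool} → (∀ k → g k ≡ h k) → O ⟦ g ⟧ i ⇔ O ⟦ h ⟧ i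
monotone-⇔ O mono e = mk⇔ (mono (⟦⟧-cong e)) (mono (⟦⟧-cong (sym ∘ e)))

-- The transition constraints of 𝒜_φ at ◇̇ψ and ⊡ψ, on the label stream c of
-- the temporal formula and the label stream f of its argument ψ.

DiaSteps : (ℕ → B4) → (ℕ → B4) → Set
DiaSteps c f = ∀ k j → π j (c k) ≡ π j (f k) ∨ π j (c (suc k))

record BoxSteps (c f : ℕ → B4) : Set where
  field
    step₁ : ∀ k → π₁ (c k) ≡ π₁ (f k) ∧ π₁ (c (suc k))
    step₂ : ∀ k → π₂ (c k) ≡ π₁ (c k) ∨ π₂ (c (suc k))
    step₃ : ∀ k → π₃ (c k) ≡ π₄ (c k) ∧ π₃ (c (suc k))
    step₄ : ∀ k → π₄ (c k) ≡ π₄ (f k) ∨ π₄ (c (suc k))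

DiaFair : (ℕ → B4) → (ℕ → B4) → Set
DiaFair c f = ∀ j → InfinitelyOften (λ k → π j (c k) ≡ false ⊎ π j (f k) ≡ true)

record BoxFair (c f : ℕ → B4) : Set where
  field
    fair₁ : InfinitelyOften (λ k → π₁ (c k) ≡ true ⊎ π₁ (f k) ≡ false)
    fair₂ : InfinitelyOften (λ k → π₂ (c k) ≡ false ⊎ π₁ (c k) ≡ true)
    fair₃ : InfinitelyOften (λ k → π₃ (c k) ≡ true ⊎ π₄ (c k) ≡ false)
    fair₄ : InfinitelyOften (λ k → π₄ (c k) ≡ false ⊎ π₄ (f k) ≡ true)

inf-intro : ∀ {g : ℕ → Bool} → Reflects (∀ k → g k ≡ true) x → IsInf g x
inf-intro r = (λ k → ≤ᴮ-intro λ t → reflects-true r t k)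
            , (λ y lb → ≤ᴮ-intro λ t → true-by r λ k → ≤ᴮ-elim (lb k) t)

sup-intro : ∀ {g : ℕ → Bool} → Reflects (∃ λ k → g k ≡ true) x → IsSup g x
sup-intro r = (λ k → ≤ᴮ-intro λ t → true-by r (k , t))
            , (λ y ub → ≤ᴮ-intro λ t → let (k , t′) = reflects-true r t in ≤ᴮ-elim (ub k) t′)

inf-offset : ∀ {g : ℕ → Bool} → Reflects (□ ⟦ g ⟧ i) x → IsInf (λ k → g (i + k)) x
inf-offset r = inf-intro (reflects-⇔ (⇔-sym □-offset) r)

sup-offset : ∀ {g : ℕ → Bool} → Reflects (◇ ⟦ g ⟧ i) x → IsSup (λ k → g (i + k)) x
sup-offset r = sup-intro (reflects-⇔ (⇔-sym ◇-offset) r)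

suffix-of : ∀ {n} {τ : Word n} σ i → (∀ m → τ m ≡ σ (i + m)) → ∀ k m → suffix k τ m ≡ σ ((i + k) + m)
suffix-of σ i e k m = trans (e (k + m)) (cong σ (sym (+-assoc i k m)))

⊑-trans : ∀ {n} {ψ χ φ : Formula n} → ψ ⊑ χ → χ ⊑ φ → ψ ⊑ φ
⊑-trans s ⊑-refl   = s
⊑-trans s (⊑-¬ t)  = ⊑-¬ (⊑-trans s t)
⊑-trans s (⊑-∨ˡ t) = ⊑-∨ˡ (⊑-trans s t)
⊑-trans s (⊑-∨ʳ t) = ⊑-∨ʳ (⊑-trans s t)
⊑-trans s (⊑-∧ˡ t) = ⊑-∧ˡ (⊑-trans s t)
⊑-trans s (⊑-∧ʳ t) = ⊑-∧ʳ (⊑-trans s t)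
⊑-trans s (⊑-⇒ˡ t) = ⊑-⇒ˡ (⊑-trans s t)
⊑-trans s (⊑-⇒ʳ t) = ⊑-⇒ʳ (⊑-trans s t)
⊑-trans s (⊑-box t) = ⊑-box (⊑-trans s t)
⊑-trans s (⊑-dia t) = ⊑-dia (⊑-trans s t)

-- Everything below uses excluded middle: to decide the temporal properties
-- defining the canonical valuation, and in proofs by contradiction.
module Classical (em : ExcludedMiddle 0ℓ) where

  dne : ¬ ¬ A → A
  dne = decidable-stable em

  ¬□⇒◇¬ : ¬ □ P i → ◇ (∁ P) i
  ¬□⇒◇¬ ¬h = dne λ ¬e → ¬h λ x ix → dne λ ¬p → ¬e (x , ix , ¬p)

  ◇□-settles : Ultimately (◇ (□ P) ⇒ □ P)
  ◇□-settles {P = P} with em {◇ (□ P) 0}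
  ... | yes (a , _ , h) = a , λ x ax _ → □-later ax h
  ... | no ¬e           = 0 , λ x _ e → ⊥-elim (¬e (◇-earlier z≤n e))

  ◇-settles : Ultimately (◇ P ⇒ □ (◇ P))
  ◇-settles {P = P} with em {◇ (∁ (◇ P)) 0}
  ... | yes (a , _ , ¬q) = a , λ x ax q → ⊥-elim (¬q (◇-earlier ax q))
  ... | no ¬e            = 0 , λ x _ _ y _ → dne λ ¬q → ¬e (y , z≤n , ¬q)

  □-◇□-ultimately-⇔ : R ⊆ P → Ultimately (P ⇒ R) → Ultimately (λ x → □ R x ⇔ ◇ (□ P) x)
  □-◇□-ultimately-⇔ RP PR = ultimately-map
    (λ settle → mk⇔ (◇-now ∘ □-map RP) (settle ∘ ◇□-map-ultimately PR)) ◇□-settles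

  □◇-◇-ultimately-⇔ : P ⊆ R → Ultimately (R ⇒ P) → Ultimately (λ x → □ (◇ P) x ⇔ ◇ R x)
  □◇-◇-ultimately-⇔ PR RP = ultimately-map
    (λ settle → mk⇔ (◇-map PR ∘ □-now) (□◇-map-ultimately RP ∘ settle)) ◇-settles

  holds : Set → Bool
  holds A = does (em {A})

  truth : Set → Set → Set → Set → B4
  truth A₁ A₂ A₃ A₄ = fromBits (holds A₁) (holds A₂) (holds A₃) (holds A₄)

  truth-coords : (A₁ → A₂) → (A₂ → A₃) → (A₃ → A₄) → Coords (truth A₁ A₂ A₃ A₄) A₁ A₂ A₃ A₄
  truth-coords = fromBits-coords (proof em) (proof em) (proof em) (proof em)

  ⊡ ◇̇ : (ℕ → B4) → ℕ → B4
  ⊡ f i = truth (□ ⟦ π₁ ∘ f ⟧ i) (◇ (□ ⟦ π₂ ∘ f ⟧) i) (□ (◇ ⟦ π₃ ∘ f ⟧) i) (◇ ⟦ π₄ ∘ f ⟧ i)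
  ◇̇ f i = truth (◇ ⟦ π₁ ∘ f ⟧ i) (◇ ⟦ π₂ ∘ f ⟧ i) (◇ ⟦ π₃ ∘ f ⟧ i) (◇ ⟦ π₄ ∘ f ⟧ i)

  ⊡-coords : ∀ f i → Coords (⊡ f i)
               (□ ⟦ π₁ ∘ f ⟧ i) (◇ (□ ⟦ π₂ ∘ f ⟧) i) (□ (◇ ⟦ π₃ ∘ f ⟧) i) (◇ ⟦ π₄ ∘ f ⟧ i)
  ⊡-coords f i = truth-coords (◇-now ∘ □-map (ascending₁₂ f))
                              (□-map (◇-map (ascending₂₃ f)) ∘ ◇□⊆□◇)
                              (◇-map (ascending₃₄ f) ∘ □-now)

  ◇̇-coords : ∀ f i → Coords (◇̇ f i) (◇ ⟦ π₁ ∘ f ⟧ i) (◇ ⟦ π₂ ∘ f ⟧ i) (◇ ⟦ π₃ ∘ f ⟧ i) (◇ ⟦ π₄ ∘ f ⟧ i)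
  ◇̇-coords f i = truth-coords (◇-map (ascending₁₂ f)) (◇-map (ascending₂₃ f)) (◇-map (ascending₃₄ f))

  ◇̇-reflects : ∀ f i j → Reflects (◇ ⟦ π j ∘ f ⟧ i) (π j (◇̇ f i))
  ◇̇-reflects f i zero                   = coord₁ (◇̇-coords f i)
  ◇̇-reflects f i (suc zero)             = coord₂ (◇̇-coords f i)
  ◇̇-reflects f i (suc (suc zero))       = coord₃ (◇̇-coords f i)
  ◇̇-reflects f i (suc (suc (suc zero))) = coord₄ (◇̇-coords f i)

  ⊡-cong : ∀ {f g} → (∀ k → f k ≡ g k) → ∀ i → ⊡ f i ≡ ⊡ g i
  ⊡-cong {f} {g} e i = coords-unique (⊡-coords f i) (coords
    (reflects-⇔ (monotone-⇔ □ □-map (back π₁)) (coord₁ (⊡-coords g i)))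
    (reflects-⇔ (monotone-⇔ (◇ ∘ □) (◇-map ∘ □-map) (back π₂)) (coord₂ (⊡-coords g i)))
    (reflects-⇔ (monotone-⇔ (□ ∘ ◇) (□-map ∘ ◇-map) (back π₃)) (coord₃ (⊡-coords g i)))
    (reflects-⇔ (monotone-⇔ ◇ ◇-map (back π₄)) (coord₄ (⊡-coords g i))))
    where
      back : ∀ (πₖ : B4 → Bool) k → πₖ (g k) ≡ πₖ (f k)
      back πₖ k = cong πₖ (sym (e k))

  ◇̇-cong : ∀ {f g} → (∀ k → f k ≡ g k) → ∀ i → ◇̇ f i ≡ ◇̇ g i
  ◇̇-cong {f} {g} e i =
    π-injective (same zero) (same (suc zero)) (same (suc (suc zero))) (same (suc (suc (suc zero))))
    where
      same : ∀ j → π j (◇̇ f i) ≡ π j (◇̇ g i)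
      same j = det-⇔ (monotone-⇔ ◇ ◇-map λ k → cong (π j) (e k)) (◇̇-reflects f i j) (◇̇-reflects g i j)

  ◇̇-steps : ∀ f → DiaSteps (◇̇ f) f
  ◇̇-steps f k j = det-⇔ ◇-unfold (◇̇-reflects f k j) (≡true-reflects _ ⊎-reflects ◇̇-reflects f (suc k) j)

  ⊡-steps : ∀ f → BoxSteps (⊡ f) f
  ⊡-steps f = record
    { step₁ = λ k → det-⇔ □-unfold (coord₁ (C k)) (≡true-reflects _ ×-reflects coord₁ (C (suc k)))
    ; step₂ = λ k → det-⇔ (◇□-unfold (ascending₁₂ f)) (coord₂ (C k))
                          (coord₁ (C k) ⊎-reflects coord₂ (C (suc k)))
    ; step₃ = λ k → det-⇔ (□◇-unfold (ascending₃₄ f)) (coord₃ (C k))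
                          (coord₄ (C k) ×-reflects coord₃ (C (suc k)))
    ; step₄ = λ k → det-⇔ ◇-unfold (coord₄ (C k)) (≡true-reflects _ ⊎-reflects coord₄ (C (suc k)))
    }
    where C = ⊡-coords f

  ◇-fair : ∀ {c p : ℕ → Bool} → (∀ k → Reflects (◇ ⟦ p ⟧ k) (c k))
         → InfinitelyOften (λ k → c k ≡ false ⊎ p k ≡ true)
  ◇-fair {p = p} r i with em {◇ ⟦ p ⟧ i}
  ... | yes (x , ix , px) = x , ix , inj₂ px
  ... | no ¬q             = i , ≤-refl , inj₁ (false-by (r i) ¬q)

  □-fair : ∀ {c p : ℕ → Bool} → (∀ k → Reflects (□ ⟦ p ⟧ k) (c k))
         → InfinitelyOften (λ k → c k ≡ true ⊎ p k ≡ false)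
  □-fair {p = p} r i with em {□ ⟦ p ⟧ i}
  ... | yes h  = i , ≤-refl , inj₁ (true-by (r i) h)
  ... | no ¬h  = let (x , ix , ¬px) = ¬□⇒◇¬ ¬h in x , ix , inj₂ (¬-not ¬px)

  ◇̇-fair : ∀ f → DiaFair (◇̇ f) f
  ◇̇-fair f j = ◇-fair λ k → ◇̇-reflects f k j

  ⊡-fair : ∀ {f} → Ultimately (Paired ∘ f) → BoxFair (⊡ f) f
  ⊡-fair {f} paired = record
    { fair₁ = □-fair (coord₁ ∘ C)
    ; fair₂ = ultimately⇒infinitely (ultimately-map
        (λ {k} e → reflects-implication (from e) (coord₂ (C k)) (coord₁ (C k)))
        (□-◇□-ultimately-⇔ (ascending₁₂ f) (paired₂⇒₁ paired)))
    ; fair₃ = ultimately⇒infinitely (ultimately-map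
        (λ {k} e → swap (reflects-implication (from e) (coord₄ (C k)) (coord₃ (C k))))
        (□◇-◇-ultimately-⇔ (ascending₃₄ f) (paired₄⇒₃ paired)))
    ; fair₄ = ◇-fair (coord₄ ∘ C)
    }
    where C = ⊡-coords f

  ◇̇-paired : ∀ {f} → Ultimately (Paired ∘ f) → Ultimately (Paired ∘ ◇̇ f)
  ◇̇-paired {f} paired = ultimately-∩
    (ultimately-map (λ {k} e → det-⇔ e (coord₁ (C k)) (coord₂ (C k)))
      (◇-ultimately-⇔ (ascending₁₂ f) (paired₂⇒₁ paired)))
    (ultimately-map (λ {k} e → det-⇔ e (coord₃ (C k)) (coord₄ (C k)))
      (◇-ultimately-⇔ (ascending₃₄ f) (paired₄⇒₃ paired)))
    where C = ◇̇-coords f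

  ⊡-paired : ∀ {f} → Ultimately (Paired ∘ f) → Ultimately (Paired ∘ ⊡ f)
  ⊡-paired {f} paired = ultimately-∩
    (ultimately-map (λ {k} e → det-⇔ e (coord₁ (C k)) (coord₂ (C k)))
      (□-◇□-ultimately-⇔ (ascending₁₂ f) (paired₂⇒₁ paired)))
    (ultimately-map (λ {k} e → det-⇔ e (coord₃ (C k)) (coord₄ (C k)))
      (□◇-◇-ultimately-⇔ (ascending₃₄ f) (paired₄⇒₃ paired)))
    where C = ⊡-coords f

  -- Acceptance pins down solutions of the transition constraints: a stream
  -- unfolding like ◇p is the least fixpoint ◇p, one unfolding like □p the greatest.

  ◇-least : ∀ {c p : ℕ → Bool} → (∀ k → c k ≡ p k ∨ c (suc k))
          → InfinitelyOften (λ k → c k ≡ false ⊎ p k ≡ true) → ∀ i → Reflects (◇ ⟦ p ⟧ i) (c i)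
  ◇-least {c} {p} step fair i = reflects-intro eventually-p p-propagates
    where
      p-propagates : ◇ ⟦ p ⟧ i → c i ≡ true
      p-propagates q = ◇-backward (λ k t → trans (step k) (trans (cong (p k ∨_) t) (∨-zeroʳ (p k))))
                                  (◇-map (λ {k} t → trans (step k) (cong (_∨ c (suc k)) t)) q)
      -- Without p, c would stay true from i on, contradicting acceptance.
      eventually-p : c i ≡ true → ◇ ⟦ p ⟧ i
      eventually-p ci = dne λ ¬q →
        let stays : □ ⟦ c ⟧ i
            stays = □-induction (λ k ik ck → subst (λ z → z ∨ c (suc k) ≡ true)
                                  (¬-not λ pk → ¬q (k , ik , pk)) (trans (sym (step k)) ck)) ci
        in case (fair i) stays ¬q
        where
          case : ◇ (λ k → c k ≡ false ⊎ p k ≡ true) i → □ ⟦ c ⟧ i → ¬ ◇ ⟦ p ⟧ i → ⊥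
          case (k , ik , inj₁ ck) stays _  = false≢true (trans (sym ck) (stays k ik))
          case (k , ik , inj₂ pk) _     ¬q = ¬q (k , ik , pk)

  □-greatest : ∀ {c p : ℕ → Bool} → (∀ k → c k ≡ p k ∧ c (suc k))
             → InfinitelyOften (λ k → c k ≡ true ⊎ p k ≡ false) → ∀ i → Reflects (□ ⟦ p ⟧ i) (c i)
  □-greatest {c} {p} step fair i = reflects-intro c-propagates always-c
    where
      c-propagates : c i ≡ true → □ ⟦ p ⟧ i
      c-propagates ci = □-map (λ {k} ck → proj₁ (∧-true (trans (sym (step k)) ck)))
                              (□-induction (λ k _ ck → proj₂ (∧-true (trans (sym (step k)) ck))) ci)
      -- Under □p, a false c would stay false from i on, contradicting acceptance.
      always-c : □ ⟦ p ⟧ i → c i ≡ true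
      always-c h = dne λ ¬ci →
        let stays : □ (∁ ⟦ c ⟧) i
            stays = □-induction (λ k ik ¬ck ck′ → ¬ck (trans (step k) (subst (λ z → z ∧ c (suc k) ≡ true)
                                  (sym (h k ik)) ck′))) ¬ci
        in case (fair i) stays
        where
          case : ◇ (λ k → c k ≡ true ⊎ p k ≡ false) i → □ (∁ ⟦ c ⟧) i → ⊥
          case (k , ik , inj₁ ck) stays = stays k ik ck
          case (k , ik , inj₂ pk) _     = false≢true (trans (sym pk) (h k ik))

  ◇̇-unique : ∀ {c f} → DiaSteps c f → DiaFair c f → ∀ i → c i ≡ ◇̇ f i
  ◇̇-unique {c} {f} steps fair i =
    π-injective (same zero) (same (suc zero)) (same (suc (suc zero))) (same (suc (suc (suc zero))))
    where
      same : ∀ j → π j (c i) ≡ π j (◇̇ f i)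
      same j = det (◇-least (λ k → steps k j) (fair j) i) (◇̇-reflects f i j)

  -- For ⊡, the second (third) coordinate is ◇ of the first (□ of the fourth);
  -- pairedness of the argument identifies these with ◇□ (□◇) of its coordinates.
  ⊡-unique : ∀ {c f} → Ultimately (Paired ∘ f) → BoxSteps c f → BoxFair c f → ∀ i → c i ≡ ⊡ f i
  ⊡-unique {c} {f} paired steps fair i = coords-unique
    (coords (r₁ i) (reflects-⇔ ◇□₁⇔◇□₂ r₂) (reflects-⇔ □◇₄⇔□◇₃ r₃) (r₄ i))
    (⊡-coords f i)
    where
      open BoxSteps steps
      open BoxFair fair
      r₁ : ∀ k → Reflects (□ ⟦ π₁ ∘ f ⟧ k) (π₁ (c k))
      r₁ = □-greatest step₁ fair₁
      r₄ : ∀ k → Reflects (◇ ⟦ π₄ ∘ f ⟧ k) (π₄ (c k))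
      r₄ = ◇-least step₄ fair₄
      r₂ : Reflects (◇ ⟦ π₁ ∘ c ⟧ i) (π₂ (c i))
      r₂ = ◇-least step₂ fair₂ i
      r₃ : Reflects (□ ⟦ π₄ ∘ c ⟧ i) (π₃ (c i))
      r₃ = □-greatest step₃ fair₃ i
      ◇□₁⇔◇□₂ : ◇ ⟦ π₁ ∘ c ⟧ i ⇔ ◇ (□ ⟦ π₂ ∘ f ⟧) i
      ◇□₁⇔◇□₂ = mk⇔ (◇-map (□-map (ascending₁₂ f)) ∘ ◇-map (reflected-⊆ r₁))
                    (◇-map (reflecting-⊆ r₁) ∘ ◇□-map-ultimately (paired₂⇒₁ paired))
      □◇₄⇔□◇₃ : □ ⟦ π₄ ∘ c ⟧ i ⇔ □ (◇ ⟦ π₃ ∘ f ⟧) i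
      □◇₄⇔□◇₃ = mk⇔ (□◇-map-ultimately (paired₄⇒₃ paired) ∘ □-map (reflected-⊆ r₄))
                    (□-map (reflecting-⊆ r₄) ∘ □-map (◇-map (ascending₃₄ f)))

  supInf-offset : ∀ {g : ℕ → Bool} → Reflects (◇ (□ ⟦ g ⟧) i) x → IsSupInf (λ k → g (i + k)) x
  supInf-offset {i = i} {g = g} r = h , inner , sup-intro (reflects-⇔ (mk⇔ ◇□⇒h ◇□⇐h) r)
    where
      h : ℕ → Bool
      h j = holds (□ ⟦ g ⟧ (i + j))
      inner : ∀ j → IsInf (λ k → g (i + (j + k))) (h j)
      inner j = inf-intro (reflects-⇔ (□-offset₂ {P = ⟦ g ⟧} {i} {j}) (proof em))
      ◇□⇒h : ◇ (□ ⟦ g ⟧) i → ∃ λ j → h j ≡ true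
      ◇□⇒h e = let (j , a) = from ◇-offset e in j , true-by (proof em) a
      ◇□⇐h : (∃ λ j → h j ≡ true) → ◇ (□ ⟦ g ⟧) i
      ◇□⇐h (j , t) = to ◇-offset (j , reflects-true (proof em) t)

  infSup-offset : ∀ {g : ℕ → Bool} → Reflects (□ (◇ ⟦ g ⟧) i) x → IsInfSup (λ k → g (i + k)) x
  infSup-offset {i = i} {g = g} r = h , inner , inf-intro (reflects-⇔ (mk⇔ □◇⇒h □◇⇐h) r)
    where
      h : ℕ → Bool
      h j = holds (◇ ⟦ g ⟧ (i + j))
      inner : ∀ j → IsSup (λ k → g (i + (j + k))) (h j)
      inner j = sup-intro (reflects-⇔ (◇-offset₂ {P = ⟦ g ⟧} {i} {j}) (proof em))
      □◇⇒h : □ (◇ ⟦ g ⟧) i → ∀ j → h j ≡ true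
      □◇⇒h a j = true-by (proof em) (from □-offset a j)
      □◇⇐h : (∀ j → h j ≡ true) → □ (◇ ⟦ g ⟧) i
      □◇⇐h a = to □-offset λ j → reflects-true (proof em) (a j)

  module Canonical {n} (σ : Word n) where

    v : Formula n → ℕ → B4
    v (atom p)   i = atomVal (σ i) p
    v (¬ᶠ ψ)     i = neg4 (v ψ i)
    v (ψ ∨ᶠ χ)   i = max4 (v ψ i) (v χ i)
    v (ψ ∧ᶠ χ)   i = min4 (v ψ i) (v χ i)
    v (ψ ⇒ᶠ χ)   i = imp4 (v ψ i) (v χ i)
    v (box ψ)      = ⊡ (v ψ)
    v (dia ψ)      = ◇̇ (v ψ)

    v-Val : ∀ ψ {τ : Word n} i → (∀ m → τ m ≡ σ (i + m)) → Val ψ τ (v ψ i)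
    v-Val (atom p) i e = cong (λ a → atomVal a p) (trans (cong σ (sym (+-identityʳ i))) (sym (e 0)))
    v-Val (¬ᶠ ψ)   i e = _ , v-Val ψ i e , refl
    v-Val (ψ ∨ᶠ χ) i e = _ , _ , v-Val ψ i e , v-Val χ i e , refl
    v-Val (ψ ∧ᶠ χ) i e = _ , _ , v-Val ψ i e , v-Val χ i e , refl
    v-Val (ψ ⇒ᶠ χ) i e = _ , _ , v-Val ψ i e , v-Val χ i e , refl
    v-Val (box ψ)  i e = (λ k → v ψ (i + k)) , (λ k → v-Val ψ (i + k) (suffix-of σ i e k))
      , inf-offset (coord₁ C) , supInf-offset (coord₂ C) , infSup-offset (coord₃ C) , sup-offset (coord₄ C)
      where C = ⊡-coords (v ψ) i
    v-Val (dia ψ)  i e = (λ k → v ψ (i + k)) , (λ k → v-Val ψ (i + k) (suffix-of σ i e k))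
      , λ j → sup-offset (◇̇-reflects (v ψ) i j)

    v-paired : ∀ ψ → Ultimately (Paired ∘ v ψ)
    v-paired (atom p) = 0 , λ x _ → paired-either (atomVal-cases (σ x) p) paired-0000 paired-1111
    v-paired (¬ᶠ ψ)   = 0 , λ x _ → paired-either (neg4-cases (v ψ x)) paired-0000 paired-1111
    v-paired (ψ ∨ᶠ χ) = ultimately-map (λ (pψ , pχ) → paired-either (max4-selective _ _) pχ pψ)
                                       (ultimately-∩ (v-paired ψ) (v-paired χ))
    v-paired (ψ ∧ᶠ χ) = ultimately-map (λ (pψ , pχ) → paired-either (min4-selective _ _) pψ pχ)
                                       (ultimately-∩ (v-paired ψ) (v-paired χ))
    v-paired (ψ ⇒ᶠ χ) = ultimately-map (λ {x} → paired-either (imp4-cases (v ψ x) (v χ x)) paired-1111)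
                                       (v-paired χ)
    v-paired (box ψ)  = ⊡-paired (v-paired ψ)
    v-paired (dia ψ)  = ◇̇-paired (v-paired ψ)

  module Runs {n} (φ : Formula n) (σ : Word n) where
    open Canonical σ

    BoxStep⇒BoxSteps : ∀ {M : ℕ → Formula n → B4} {ψ} → (∀ k → BoxStep φ (M k) (M (suc k)) ψ)
                     → BoxSteps (λ k → M k (box ψ)) (λ k → M k ψ)
    BoxStep⇒BoxSteps {M} {ψ} bs = record
      { step₁ = λ k → proj₁ (bs k)
      ; step₂ = λ k → trans (proj₁ (proj₂ (bs k)))
                            (cong (_∨ π₂ (M (suc k) (box ψ))) (sym (proj₁ (bs k))))
      ; step₃ = λ k → trans (proj₁ (proj₂ (proj₂ (bs k))))
                            (cong (_∧ π₃ (M (suc k) (box ψ))) (sym (proj₂ (proj₂ (proj₂ (bs k))))))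
      ; step₄ = λ k → proj₂ (proj₂ (proj₂ (bs k)))
      }

    BoxSteps⇒BoxStep : ∀ {M : ℕ → Formula n → B4} {ψ} → BoxSteps (λ k → M k (box ψ)) (λ k → M k ψ)
                     → ∀ k → BoxStep φ (M k) (M (suc k)) ψ
    BoxSteps⇒BoxStep {M} {ψ} steps k =
      step₁ k , trans (step₂ k) (cong (_∨ π₂ (M (suc k) (box ψ))) (step₁ k))
              , trans (step₃ k) (cong (_∧ π₃ (M (suc k) (box ψ))) (step₄ k)) , step₄ k
      where open BoxSteps steps

    -- The label of a state; initial states carry none and occur only at time 0.
    label : Q φ → Formula n → B4
    label (init _) _ = b0000
    label (st μ _)   = μ

    onS-label : ∀ {Pμ : (Formula n → B4) → Set} q → onS φ Pμ q → Pμ (label q)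
    onS-label (st _ _) p = p

    target-InS : ∀ {q a q′} → Δ φ q a q′ → InS φ (label q′)
    target-InS {init _} {q′ = st _ s} _ = s
    target-InS {st _ _} {q′ = st _ s} _ = s

    target-matches : ∀ {q a q′} → Δ φ q a q′ → Matches φ (label q′) a
    target-matches {init _} {q′ = st _ _} (_ , m) = m
    target-matches {st _ _} {q′ = st _ _} (m , _) = m

    initial-label : ∀ {b a q} → Δ φ (init b) a q → label q φ ≡ b
    initial-label {q = st _ _} (e , _) = e

    consecutive : ∀ {q₀ q₁ q₂ a a′} → Δ φ q₀ a q₁ → Δ φ q₁ a′ q₂
                → (∀ ψ → dia ψ ⊑ φ → DiaStep φ (label q₁) (label q₂) ψ)
                × (∀ ψ → box ψ ⊑ φ → BoxStep φ (label q₁) (label q₂) ψ)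
    consecutive {q₁ = st _ _} {q₂ = st _ _} _ (_ , d , b) = d , b
    consecutive {init _} {q₁ = init _} ()
    consecutive {st _ _} {q₁ = init _} ()

    module Sound {b} {r : ℕ → Q φ} (run : IsRun φ σ (init b) r) (acc : Accepting φ r) where

      M : ℕ → Formula n → B4
      M k = label (r (suc k))

      transition : ∀ k → Δ φ (r k) (σ k) (r (suc k))
      transition = proj₂ run

      labels-fair : ∀ {Pμ} → InfOften φ (onS φ Pμ) r → InfinitelyOften (λ k → Pμ (M k))
      labels-fair io i with io (suc i)
      ... | suc k , s≤s ik , p = k , ik , onS-label (r (suc k)) p

      -- By induction on ψ: locally by consistency of states, at ⊡ and ◇̇ by uniqueness.
      agree : ∀ ψ → ψ ⊑ φ → ∀ k → M k ψ ≡ v ψ k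
      agree (atom p) s k = target-matches (transition k) p s
      agree (¬ᶠ ψ)   s k = trans (target-InS (transition k) _ s)
        (cong neg4 (agree ψ (⊑-trans (⊑-¬ ⊑-refl) s) k))
      agree (ψ ∨ᶠ χ) s k = trans (target-InS (transition k) _ s)
        (cong₂ max4 (agree ψ (⊑-trans (⊑-∨ˡ ⊑-refl) s) k) (agree χ (⊑-trans (⊑-∨ʳ ⊑-refl) s) k))
      agree (ψ ∧ᶠ χ) s k = trans (target-InS (transition k) _ s)
        (cong₂ min4 (agree ψ (⊑-trans (⊑-∧ˡ ⊑-refl) s) k) (agree χ (⊑-trans (⊑-∧ʳ ⊑-refl) s) k))
      agree (ψ ⇒ᶠ χ) s k = trans (target-InS (transition k) _ s)
        (cong₂ imp4 (agree ψ (⊑-trans (⊑-⇒ˡ ⊑-refl) s) k) (agree χ (⊑-trans (⊑-⇒ʳ ⊑-refl) s) k))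
      agree (dia ψ)  s k = trans (◇̇-unique steps fair k) (◇̇-cong (agree ψ (⊑-trans (⊑-dia ⊑-refl) s)) k)
        where
          steps : DiaSteps (λ k → M k (dia ψ)) (λ k → M k ψ)
          steps k = proj₁ (consecutive (transition k) (transition (suc k))) ψ s
          fair : DiaFair (λ k → M k (dia ψ)) (λ k → M k ψ)
          fair j = labels-fair (acc (diaF ψ s j))
      agree (box ψ)  s k = trans (⊡-unique paired steps fair k) (⊡-cong agree-ψ k)
        where
          agree-ψ : ∀ k → M k ψ ≡ v ψ k
          agree-ψ = agree ψ (⊑-trans (⊑-box ⊑-refl) s)
          paired : Ultimately (Paired ∘ λ k → M k ψ)
          paired = ultimately-map (λ {x} → subst Paired (sym (agree-ψ x))) (v-paired ψ)
          steps : BoxSteps (λ k → M k (box ψ)) (λ k → M k ψ)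
          steps = BoxStep⇒BoxSteps {M} {ψ} λ k → proj₂ (consecutive (transition k) (transition (suc k))) ψ s
          fair : BoxFair (λ k → M k (box ψ)) (λ k → M k ψ)
          fair = record
            { fair₁ = labels-fair (acc (boxF ψ s zero))
            ; fair₂ = labels-fair (acc (boxF ψ s (suc zero)))
            ; fair₃ = labels-fair (acc (boxF ψ s (suc (suc zero))))
            ; fair₄ = labels-fair (acc (boxF ψ s (suc (suc (suc zero)))))
            }

      sound : Val φ σ b
      sound = subst (Val φ σ) v≡b (v-Val φ 0 λ _ → refl)
        where
          v≡b : v φ 0 ≡ b
          v≡b = trans (sym (agree φ ⊑-refl 0))
                      (initial-label (subst (λ q → Δ φ q (σ 0) (r 1)) (proj₁ run) (transition 0)))

    module Complete {b} (vb : Val φ σ b) where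

      v-InS : ∀ k → InS φ (λ ψ → v ψ k)
      v-InS k (atom p) _ = atomVal-cases (σ k) p
      v-InS k (¬ᶠ _)   _ = refl
      v-InS k (_ ∨ᶠ _) _ = refl
      v-InS k (_ ∧ᶠ _) _ = refl
      v-InS k (_ ⇒ᶠ _) _ = refl
      v-InS k (box _)  _ = tt
      v-InS k (dia _)  _ = tt

      r : ℕ → Q φ
      r zero    = init b
      r (suc k) = st (λ ψ → v ψ k) (v-InS k)

      transition : ∀ k → Δ φ (r k) (σ k) (r (suc k))
      transition zero    = Val-functional φ (v-Val φ 0 λ _ → refl) vb , λ _ _ → refl
      transition (suc k) = (λ _ _ → refl) , (λ ψ _ → ◇̇-steps (v ψ) k)
                         , (λ ψ _ → BoxSteps⇒BoxStep {λ k χ → v χ k} {ψ} (⊡-steps (v ψ)) k)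

      canonical-fair : ∀ {Pμ} → InfinitelyOften (λ k → Pμ (λ ψ → v ψ k)) → InfOften φ (onS φ Pμ) r
      canonical-fair io i = let (k , ik , p) = io i in suc k , m≤n⇒m≤1+n ik , p

      open BoxFair

      accepting : Accepting φ r
      accepting (diaF ψ _ j)                      = canonical-fair (◇̇-fair (v ψ) j)
      accepting (boxF ψ _ zero)                   = canonical-fair (fair₁ (⊡-fair (v-paired ψ)))
      accepting (boxF ψ _ (suc zero))             = canonical-fair (fair₂ (⊡-fair (v-paired ψ)))
      accepting (boxF ψ _ (suc (suc zero)))       = canonical-fair (fair₃ (⊡-fair (v-paired ψ)))
      accepting (boxF ψ _ (suc (suc (suc zero)))) = canonical-fair (fair₄ (⊡-fair (v-paired ψ)))

      complete : AcceptsFrom φ σ (init b)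
      complete = r , (refl , transition) , accepting

theorem1 : ExcludedMiddle 0ℓ → {m : ℕ} (φ : Formula (suc m)) (σ : Word (suc m)) (b : B4) →
    AcceptsFrom φ σ (init b) ⇔ Val φ σ b
theorem1 em φ σ b = mk⇔ (λ (r , run , acc) → Sound.sound run acc) (Complete.complete)
  where open Classical.Runs em φ σ
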